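{- Let $t\ge 2$ be an integer. For $n\ge 0$ let $c_n$ denote the number of finite sequences $(a_0,a_1,\ldots,a_l)$ with $l\ge 0$, each $a_i$ a nonnegative integer, $a_l>0$, $\sum_{i=0}^l a_i = 1+n(t-1)$ and $\sum_{i=0}^l a_i t^{ -i}=1$ (equivalently, $c_n$ is the number of equivalence classes of $t$-ary rooted trees with $n$ inner vertices, two trees being equivalent if they have the same number of leaves at distance $i$ from the root for every $i$). Let $F(q)=\sum_{n\ge0}c_nq^n$. Then \[ F(q)=\frac{\displaystyle\sum_{j=0}^{\infty}(-1)^j q^{[j]}\prod_{i=1}^{j}\frac{q^{[i]}}{1-q^{[i]}}}{\displaystyle\sum_{j=0}^\infty (-1)^{j} \prod_{i=1}^{j}\frac{q^{[i]}}{1-q^{[i]}}}, \] where $[k]:=1+t+t^2+\cdots+t^{k-1}$ (so $[0]=0$).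
   Context: A $t$-ary rooted tree here is a rooted tree in which every vertex is either a leaf or has exactly $t$ children; inner vertices are the non-leaves (the root is an inner vertex unless the tree is a single vertex). Empty products equal $1$. The identity may be read as an identity of formal power series in $q$ (both sums converge formally, and the denominator has constant term $1$), and equally as an identity of analytic functions for $|q|<1/2$. -}

module Defs where

open import Data.Nat as ℕ using (ℕ; zero; suc; _+_; _∸_; _^_; _≤_; _<_; s≤s; z≤n; NonZero)
open import Data.Nat.Properties using (m^n≢0; ≤-trans)
open import Data.Integer as ℤ using (ℤ; +_)
open import Data.Rational as ℚ using (ℚ; 0ℚ; 1ℚ)
open import Data.List using (List; []; _∷_)
open import Data.Nat.ListAction using (sum)
open import Relation.Nullary using (yes; no)
open import Data.Empty using (⊥)
open import Data.Product using (_×_)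
open import Relation.Binary.PropositionalEquality using (_≡_)

weightedSum : (t : ℕ) → .{{NonZero t}} → ℕ → List ℕ → ℚ
weightedSum t k [] = 0ℚ
weightedSum t k (a ∷ as) =
  ((+ a) ℚ./ (t ^ k)) {{m^n≢0 t k}} ℚ.+ weightedSum t (suc k) as

LastPos : List ℕ → Set
LastPos [] = ⊥
LastPos (a ∷ []) = 0 < a
LastPos (a ∷ b ∷ as) = LastPos (b ∷ as)

ValidSeq : (t : ℕ) → 2 ≤ t → ℕ → List ℕ → Set
ValidSeq t h n as =
  LastPos as × (sum as ≡ 1 + n ℕ.* (t ∸ 1))
             × (weightedSum t {{ℕ.>-nonZero (≤-trans (s≤s z≤n) h)}} 0 as ≡ 1ℚ)

Series : Set
Series = ℕ → ℤ

sumTo : ℕ → (ℕ → ℤ) → ℤ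
sumTo zero f = f 0
sumTo (suc n) f = sumTo n f ℤ.+ f (suc n)

sumFrom1 : ℕ → (ℕ → ℤ) → ℤ
sumFrom1 zero f = + 0
sumFrom1 (suc n) f = sumFrom1 n f ℤ.+ f (suc n)

_⊕_ : Series → Series → Series
(a ⊕ b) n = a n ℤ.+ b n

_⊖_ : Series → Series → Series
(a ⊖ b) n = a n ℤ.- b n

_⊛_ : Series → Series → Series
(a ⊛ b) n = sumTo n (λ k → a k ℤ.* b (n ∸ k))

_·_ : ℤ → Series → Series
(c · a) n = c ℤ.* a n

mono : ℕ → Series
mono k n with k ℕ.≟ n
... | yes _ = + 1
... | no _ = + 0

one : Series
one = mono 0

-- multiplicative inverse of a series with constant term 1:
-- b_0 = 1, b_n = - Σ_{k=1}^n a_k b_{n-k}   (fuel-bounded recursion)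
invGo : Series → ℕ → ℕ → ℤ
invGo a zero n = + 0
invGo a (suc f) zero = + 1
invGo a (suc f) (suc n) = ℤ.- sumFrom1 (suc n) (λ k → a k ℤ.* invGo a f (suc n ∸ k))

inv : Series → Series
inv a n = invGo a (suc n) n

bracket : ℕ → ℕ → ℕ
bracket t zero = 0
bracket t (suc k) = bracket t k + t ^ k

fracTerm : ℕ → ℕ → Series
fracTerm t i = mono (bracket t i) ⊛ inv (one ⊖ mono (bracket t i))

prodTo : ℕ → ℕ → Series
prodTo t zero = one
prodTo t (suc j) = prodTo t j ⊛ fracTerm t (suc j)

sign : ℕ → ℤ
sign j = (ℤ.- (+ 1)) ℤ.^ j

-- Infinite sums Σ_{j≥0} g_j: coefficient of q^n.  Since the j-th term has
-- q-adic order ≥ [1]+…+[j] ≥ j, only j ≤ n contribute to q^n.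
Numer : ℕ → Series
Numer t n = sumTo n (λ j → (sign j · (mono (bracket t j) ⊛ prodTo t j)) n)

Denom : ℕ → Series
Denom t n = sumTo n (λ j → (sign j · prodTo t j) n)

-- For m ≥ 0 let S_m(q) = Σ_n s(m,n) q^n, where s(m,n) counts the sequences (a_0,…,a_l)
-- with a_l > 0, Σ a_i t^(-i) = m and Σ a_i = m + n(t-1); thus F = S_1. Lowering a_0 by one
-- when it is positive, and dropping it when it is zero (which multiplies the weight by t),
-- gives S_0 = 1 and S_(m+1) = S_m + q^(m+1) S_(t(m+1)), and these equations determine
-- every coefficient by induction on n. On the other side let
-- N_m = Σ_j (-1)^j q^(m[j]) P_j with P_j = Π_(i≤j) q^[i]/(1-q^[i]). Since [j+1] = 1 + t[j]
-- and (1 - q^[j+1]) P_(j+1) = q^[j+1] P_j, the sum telescopes to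
-- N_(m+1) = N_m + q^(m+1) N_(t(m+1)); so N_m / N_0 solves the same equations, and N_1 / N_0
-- is the right-hand side of the theorem.

module Submission where

open import Defs
open import Data.Nat as ℕ using (ℕ; zero; suc; _∸_; _≤_; _<_; s≤s; z≤n; _≤?_; _<?_; NonZero)
import Data.Nat.Properties as ℕP
open import Data.Nat.Induction using (<-rec)
import Data.Nat.Tactic.RingSolver as ℕSolver
open import Data.Nat.ListAction using (sum)
open import Data.Integer as ℤ using (ℤ; +_)
import Data.Integer.Properties as ℤP
open import Data.Integer.Tactic.RingSolver using (solve-∀)
open import Data.Rational as ℚ using (0ℚ; 1ℚ; toℚᵘ)
import Data.Rational.Properties as ℚP
open import Data.Rational.Unnormalised as ℚᵘ using (ℚᵘ; *≡*; _≃_)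
import Data.Rational.Unnormalised.Properties as ℚᵘP
open import Data.List using (List; []; _∷_; length)
open import Data.Product using (Σ; _×_; _,_)
open import Data.Sum using (_⊎_; inj₁; inj₂)
open import Data.Unit using (⊤; tt)
open import Data.Empty using (⊥-elim)
open import Data.Fin using (Fin)
open import Data.Fin.Properties using (+↔⊎; 1↔⊤)
open import Data.Fin.Permutation using (↔⇒≡)
open import Data.Sum.Function.Propositional using (_⊎-↔_)
open import Function.Bundles using (_↔_; mk↔ₛ′)
open import Function.Construct.Symmetry using (↔-sym)
open import Function.Construct.Composition using (_↔-∘_)
import Axiom.UniquenessOfIdentityProofs as UIP
open import Relation.Nullary using (Dec; ¬_; yes; no)
open import Relation.Binary.PropositionalEquality hiding ([_])

module PowerSeries where

  open import Data.Integer using (_+_; _*_; -_; _-_)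

  sumTo-cong : ∀ n {f g : ℕ → ℤ} → (∀ k → k ≤ n → f k ≡ g k) → sumTo n f ≡ sumTo n g
  sumTo-cong zero f≡g = f≡g 0 z≤n
  sumTo-cong (suc n) f≡g =
    cong₂ _+_ (sumTo-cong n (λ k k≤n → f≡g k (ℕP.m≤n⇒m≤1+n k≤n))) (f≡g (suc n) ℕP.≤-refl)

  sumTo-zero : ∀ n {f : ℕ → ℤ} → (∀ k → k ≤ n → f k ≡ + 0) → sumTo n f ≡ + 0
  sumTo-zero zero f≡0 = f≡0 0 z≤n
  sumTo-zero (suc n) f≡0 =
    cong₂ _+_ (sumTo-zero n (λ k k≤n → f≡0 k (ℕP.m≤n⇒m≤1+n k≤n))) (f≡0 (suc n) ℕP.≤-refl)

  sumTo-+ : ∀ n (f g : ℕ → ℤ) → sumTo n (λ k → f k + g k) ≡ sumTo n f + sumTo n g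
  sumTo-+ zero f g = refl
  sumTo-+ (suc n) f g = begin
      sumTo n (λ k → f k + g k) + (f (suc n) + g (suc n))
    ≡⟨ cong (_+ (f (suc n) + g (suc n))) (sumTo-+ n f g) ⟩
      (sumTo n f + sumTo n g) + (f (suc n) + g (suc n))
    ≡⟨ interchange (sumTo n f) (sumTo n g) (f (suc n)) (g (suc n)) ⟩
      (sumTo n f + f (suc n)) + (sumTo n g + g (suc n)) ∎
    where
    open ≡-Reasoning
    interchange : ∀ a b c d → (a + b) + (c + d) ≡ (a + c) + (b + d)
    interchange = solve-∀

  sumTo-neg : ∀ n (f : ℕ → ℤ) → sumTo n (λ k → - f k) ≡ - sumTo n f
  sumTo-neg zero f = refl
  sumTo-neg (suc n) f =
    trans (cong (_+ - f (suc n)) (sumTo-neg n f)) (sym (ℤP.neg-distrib-+ (sumTo n f) (f (suc n))))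

  sumTo-unfoldˡ : ∀ n (f : ℕ → ℤ) → sumTo (suc n) f ≡ f 0 + sumTo n (λ k → f (suc k))
  sumTo-unfoldˡ zero f = refl
  sumTo-unfoldˡ (suc n) f =
    trans (cong (_+ f (suc (suc n))) (sumTo-unfoldˡ n f)) (ℤP.+-assoc (f 0) _ _)

  sumTo≡head+sumFrom1 : ∀ n (f : ℕ → ℤ) → sumTo n f ≡ f 0 + sumFrom1 n f
  sumTo≡head+sumFrom1 zero f = sym (ℤP.+-identityʳ (f 0))
  sumTo≡head+sumFrom1 (suc n) f =
    trans (cong (_+ f (suc n)) (sumTo≡head+sumFrom1 n f)) (ℤP.+-assoc (f 0) _ _)

  sumFrom1-cong : ∀ n {f g : ℕ → ℤ} → (∀ k → 1 ≤ k → k ≤ n → f k ≡ g k) →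
                  sumFrom1 n f ≡ sumFrom1 n g
  sumFrom1-cong zero f≡g = refl
  sumFrom1-cong (suc n) f≡g =
    cong₂ _+_ (sumFrom1-cong n (λ k 1≤k k≤n → f≡g k 1≤k (ℕP.m≤n⇒m≤1+n k≤n)))
              (f≡g (suc n) (s≤s z≤n) ℕP.≤-refl)

  sumTo-reverse : ∀ n (f : ℕ → ℤ) → sumTo n f ≡ sumTo n (λ k → f (n ∸ k))
  sumTo-reverse zero f = refl
  sumTo-reverse (suc n) f = begin
      sumTo n f + f (suc n)
    ≡⟨ cong (_+ f (suc n)) (sumTo-reverse n f) ⟩
      sumTo n (λ k → f (n ∸ k)) + f (suc n)
    ≡⟨ ℤP.+-comm (sumTo n (λ k → f (n ∸ k))) (f (suc n)) ⟩
      f (suc n) + sumTo n (λ k → f (n ∸ k))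
    ≡⟨ sym (sumTo-unfoldˡ n (λ k → f (suc n ∸ k))) ⟩
      sumTo (suc n) (λ k → f (suc n ∸ k)) ∎
    where open ≡-Reasoning

  sumTo-truncate : ∀ r n (f : ℕ → ℤ) → r ≤ n → (∀ j → r < j → f j ≡ + 0) →
                   sumTo n f ≡ sumTo r f
  sumTo-truncate r zero f z≤n _ = refl
  sumTo-truncate r (suc n) f r≤1+n f≡0 with r ℕ.≟ suc n
  ... | yes refl = refl
  ... | no r≢1+n =
    trans (cong₂ _+_ (sumTo-truncate r n f r≤n f≡0) (f≡0 (suc n) (s≤s r≤n)))
          (ℤP.+-identityʳ (sumTo r f))
    where r≤n = ℕP.≤-pred (ℕP.≤∧≢⇒< r≤1+n r≢1+n)

  OrderAtLeast : ℕ → Series → Set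
  OrderAtLeast p a = ∀ x → x < p → a x ≡ + 0

  -- Σ_(j ≥ 0) S j; cutting the sum at j ≤ n is exact when S j has order at least j.
  infiniteSum : (ℕ → Series) → Series
  infiniteSum S n = sumTo n (λ j → S j n)

  shift : ℕ → Series → Series
  shift zero a n = a n
  shift (suc K) a zero = + 0
  shift (suc K) a (suc n) = shift K a n

  shift-< : ∀ K {n} a → n < K → shift K a n ≡ + 0
  shift-< (suc K) {zero} a _ = refl
  shift-< (suc K) {suc n} a (s≤s n<K) = shift-< K a n<K

  shift-≤ : ∀ K {n} a → K ≤ n → shift K a n ≡ a (n ∸ K)
  shift-≤ zero a _ = refl
  shift-≤ (suc K) {suc n} a (s≤s K≤n) = shift-≤ K a K≤n

  shift-cong : ∀ K {a b} → a ≗ b → shift K a ≗ shift K b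
  shift-cong zero a≗b n = a≗b n
  shift-cong (suc K) a≗b zero = refl
  shift-cong (suc K) a≗b (suc n) = shift-cong K a≗b n

  shift-shift : ∀ K L a → shift K (shift L a) ≗ shift (K ℕ.+ L) a
  shift-shift zero L a n = refl
  shift-shift (suc K) L a zero = refl
  shift-shift (suc K) L a (suc n) = shift-shift K L a n

  shift-map : ∀ K (f : ℤ → ℤ) → f (+ 0) ≡ + 0 → ∀ a → shift K (λ x → f (a x)) ≗ λ x → f (shift K a x)
  shift-map zero f f0 a n = refl
  shift-map (suc K) f f0 a zero = sym f0
  shift-map (suc K) f f0 a (suc n) = shift-map K f f0 a n

  shift-⊖ : ∀ K a b → shift K (a ⊖ b) ≗ shift K a ⊖ shift K b
  shift-⊖ zero a b n = refl
  shift-⊖ (suc K) a b zero = refl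
  shift-⊖ (suc K) a b (suc n) = shift-⊖ K a b n

  shift-order : ∀ K {p} a → OrderAtLeast p a → OrderAtLeast p (shift K a)
  shift-order zero a ord x x<p = ord x x<p
  shift-order (suc K) a ord zero x<p = refl
  shift-order (suc K) a ord (suc x) x<p = shift-order K a ord x (ℕP.<-trans (ℕP.n<1+n x) x<p)

  shift-infiniteSum : ∀ K (S : ℕ → Series) → (∀ j → OrderAtLeast j (S j)) →
                      shift K (infiniteSum S) ≗ infiniteSum (λ j → shift K (S j))
  shift-infiniteSum K S ord n with K ≤? n
  ... | no K≰n = trans (shift-< K _ K>n) (sym (sumTo-zero n (λ j _ → shift-< K (S j) K>n)))
    where K>n = ℕP.≰⇒> K≰n
  ... | yes K≤n = begin
      shift K (infiniteSum S) n
    ≡⟨ shift-≤ K _ K≤n ⟩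
      sumTo (n ∸ K) (λ j → S j (n ∸ K))
    ≡⟨ sym (sumTo-truncate (n ∸ K) n _ (ℕP.m∸n≤m n K) (λ j lt → ord j (n ∸ K) lt)) ⟩
      sumTo n (λ j → S j (n ∸ K))
    ≡⟨ sumTo-cong n (λ j _ → sym (shift-≤ K (S j) K≤n)) ⟩
      sumTo n (λ j → shift K (S j) n) ∎
    where open ≡-Reasoning

  mono-diag : ∀ K → mono K K ≡ + 1
  mono-diag K with K ℕ.≟ K
  ... | yes _ = refl
  ... | no K≢K = ⊥-elim (K≢K refl)

  mono-off-diag : ∀ {K n} → K ≢ n → mono K n ≡ + 0
  mono-off-diag {K} {n} K≢n with K ℕ.≟ n
  ... | yes K≡n = ⊥-elim (K≢n K≡n)
  ... | no _ = refl

  mono-suc : ∀ K n → mono (suc K) (suc n) ≡ mono K n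
  mono-suc K n = by-cases (K ℕ.≟ n)
    where
    by-cases : Dec (K ≡ n) → mono (suc K) (suc n) ≡ mono K n
    by-cases (yes refl) = trans (mono-diag (suc K)) (sym (mono-diag K))
    by-cases (no K≢n) =
      trans (mono-off-diag (λ eq → K≢n (ℕP.suc-injective eq))) (sym (mono-off-diag K≢n))

  mono≗shift-one : ∀ K → mono K ≗ shift K one
  mono≗shift-one zero n = refl
  mono≗shift-one (suc K) zero = refl
  mono≗shift-one (suc K) (suc n) = trans (mono-suc K n) (mono≗shift-one K n)

  ⊛-congˡ : ∀ {a a'} b → a ≗ a' → (a ⊛ b) ≗ (a' ⊛ b)
  ⊛-congˡ b a≗a' n = sumTo-cong n (λ k _ → cong (_* b (n ∸ k)) (a≗a' k))

  ⊛-comm : ∀ a b → (a ⊛ b) ≗ (b ⊛ a)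
  ⊛-comm a b n = trans (sumTo-reverse n _) (sumTo-cong n λ k k≤n →
    trans (ℤP.*-comm (a (n ∸ k)) _) (cong (λ i → b i * a (n ∸ k)) (ℕP.m∸[m∸n]≡n k≤n)))

  ⊛-identityˡ : ∀ a → (one ⊛ a) ≗ a
  ⊛-identityˡ a zero = ℤP.*-identityˡ (a 0)
  ⊛-identityˡ a (suc n) = begin
      sumTo (suc n) (λ k → one k * a (suc n ∸ k))
    ≡⟨ sumTo-unfoldˡ n _ ⟩
      + 1 * a (suc n) + sumTo n (λ k → + 0 * a (n ∸ k))
    ≡⟨ cong₂ _+_ (ℤP.*-identityˡ (a (suc n))) (sumTo-zero n (λ k _ → ℤP.*-zeroˡ (a (n ∸ k)))) ⟩
      a (suc n) + + 0
    ≡⟨ ℤP.+-identityʳ (a (suc n)) ⟩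
      a (suc n) ∎
    where open ≡-Reasoning

  shift-⊛ : ∀ K a b → (shift K a ⊛ b) ≗ shift K (a ⊛ b)
  shift-⊛ zero a b n = refl
  shift-⊛ (suc K) a b zero = ℤP.*-zeroˡ (b 0)
  shift-⊛ (suc K) a b (suc n) = begin
      sumTo (suc n) (λ k → shift (suc K) a k * b (suc n ∸ k))
    ≡⟨ sumTo-unfoldˡ n _ ⟩
      + 0 * b (suc n) + (shift K a ⊛ b) n
    ≡⟨ cong (_+ (shift K a ⊛ b) n) (ℤP.*-zeroˡ (b (suc n))) ⟩
      + 0 + (shift K a ⊛ b) n
    ≡⟨ ℤP.+-identityˡ _ ⟩
      (shift K a ⊛ b) n
    ≡⟨ shift-⊛ K a b n ⟩
      shift K (a ⊛ b) n ∎
    where open ≡-Reasoning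

  mono-⊛ : ∀ K a → (mono K ⊛ a) ≗ shift K a
  mono-⊛ K a n = begin
      (mono K ⊛ a) n        ≡⟨ ⊛-congˡ a (mono≗shift-one K) n ⟩
      (shift K one ⊛ a) n   ≡⟨ shift-⊛ K one a n ⟩
      shift K (one ⊛ a) n   ≡⟨ shift-cong K (⊛-identityˡ a) n ⟩
      shift K a n           ∎
    where open ≡-Reasoning

  ⊛-distribʳ-⊕ : ∀ a b c → ((a ⊕ b) ⊛ c) ≗ (a ⊛ c) ⊕ (b ⊛ c)
  ⊛-distribʳ-⊕ a b c n =
    trans (sumTo-cong n (λ k _ → ℤP.*-distribʳ-+ (c (n ∸ k)) (a k) (b k))) (sumTo-+ n _ _)

  ⊛-distribʳ-⊖ : ∀ a b c → ((a ⊖ b) ⊛ c) ≗ (a ⊛ c) ⊖ (b ⊛ c)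
  ⊛-distribʳ-⊖ a b c n = begin
      sumTo n (λ k → (a k - b k) * c (n ∸ k))
    ≡⟨ sumTo-cong n (λ k _ → distrib (a k) (b k) (c (n ∸ k))) ⟩
      sumTo n (λ k → a k * c (n ∸ k) + - (b k * c (n ∸ k)))
    ≡⟨ sumTo-+ n _ _ ⟩
      (a ⊛ c) n + sumTo n (λ k → - (b k * c (n ∸ k)))
    ≡⟨ cong (λ s → (a ⊛ c) n + s) (sumTo-neg n _) ⟩
      (a ⊛ c) n - (b ⊛ c) n ∎
    where
    open ≡-Reasoning
    distrib : ∀ x y z → (x - y) * z ≡ x * z + - (y * z)
    distrib = solve-∀

  ⊛-order : ∀ p r {a b} → OrderAtLeast p a → OrderAtLeast r b → OrderAtLeast (p ℕ.+ r) (a ⊛ b)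
  ⊛-order p r {a} {b} ord-a ord-b n n<p+r = sumTo-zero n product-zero
    where
    product-zero : ∀ k → k ≤ n → a k * b (n ∸ k) ≡ + 0
    product-zero k k≤n with k <? p
    ... | yes k<p = trans (cong (_* b (n ∸ k)) (ord-a k k<p)) (ℤP.*-zeroˡ (b (n ∸ k)))
    ... | no k≮p = trans (cong (a k *_) (ord-b (n ∸ k) n∸k<r)) (ℤP.*-zeroʳ (a k))
      where
      p≤k = ℕP.≮⇒≥ k≮p
      n∸p<r : n ∸ p < r
      n∸p<r = ℕP.+-cancelˡ-< p (n ∸ p) r
        (subst (_< p ℕ.+ r) (sym (ℕP.m+[n∸m]≡n (ℕP.≤-trans p≤k k≤n))) n<p+r)
      n∸k<r = ℕP.≤-<-trans (ℕP.∸-monoʳ-≤ n p≤k) n∸p<r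

  invGo-fuel : ∀ a f f' m → m < f → m < f' → invGo a f m ≡ invGo a f' m
  invGo-fuel a (suc f) (suc f') zero _ _ = refl
  invGo-fuel a (suc f) (suc f') (suc m) (s≤s m<f) (s≤s m<f') =
    cong -_ (sumFrom1-cong (suc m) λ { (suc k) _ _ →
      cong (a (suc k) *_) (invGo-fuel a f f' (m ∸ k)
        (ℕP.≤-<-trans (ℕP.m∸n≤m m k) m<f) (ℕP.≤-<-trans (ℕP.m∸n≤m m k) m<f')) })

  ⊛-inverseʳ : ∀ a → a 0 ≡ + 1 → (a ⊛ inv a) ≗ one
  ⊛-inverseʳ a a0≡1 zero = cong (_* + 1) a0≡1
  ⊛-inverseʳ a a0≡1 (suc n) = begin
      sumTo (suc n) (λ k → a k * inv a (suc n ∸ k))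
    ≡⟨ sumTo≡head+sumFrom1 (suc n) _ ⟩
      a 0 * inv a (suc n) + sumFrom1 (suc n) (λ k → a k * inv a (suc n ∸ k))
    ≡⟨ cong₂ _+_ (cong (_* inv a (suc n)) a0≡1) (sumFrom1-cong (suc n) λ { (suc k) _ _ →
         cong (a (suc k) *_) (invGo-fuel a _ (suc n) (n ∸ k) (ℕP.n<1+n _) (s≤s (ℕP.m∸n≤m n k))) }) ⟩
      + 1 * - S + S
    ≡⟨ cancel S ⟩
      + 0 ∎
    where
    open ≡-Reasoning
    S = sumFrom1 (suc n) (λ k → a k * invGo a (suc n) (suc n ∸ k))
    cancel : ∀ x → + 1 * - x + x ≡ + 0
    cancel = solve-∀

  geometric : ℕ → Series
  geometric K = inv (one ⊖ mono K)

  geometric-rec : ∀ {K} → 1 ≤ K → geometric K ⊖ shift K (geometric K) ≗ one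
  geometric-rec {K} 1≤K n = begin
      geometric K n - shift K (geometric K) n
    ≡⟨ cong₂ _-_ (sym (⊛-identityˡ (geometric K) n)) (sym (mono-⊛ K (geometric K) n)) ⟩
      (one ⊛ geometric K) n - (mono K ⊛ geometric K) n
    ≡⟨ sym (⊛-distribʳ-⊖ one (mono K) (geometric K) n) ⟩
      ((one ⊖ mono K) ⊛ geometric K) n
    ≡⟨ ⊛-inverseʳ (one ⊖ mono K) (cong (λ x → + 1 - x) (mono-off-diag (ℕP.>⇒≢ 1≤K))) n ⟩
      one n ∎
    where open ≡-Reasoning

  mono⊛geometric-rec : ∀ {K} → 1 ≤ K →
    (mono K ⊛ geometric K) ⊖ shift K (mono K ⊛ geometric K) ≗ mono K
  mono⊛geometric-rec {K} 1≤K n = begin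
      (f ⊖ shift K f) n
    ≡⟨ cong₂ _-_ (mono-⊛ K g n) (shift-cong K (mono-⊛ K g) n) ⟩
      (shift K g ⊖ shift K (shift K g)) n
    ≡⟨ sym (shift-⊖ K g (shift K g) n) ⟩
      shift K (g ⊖ shift K g) n
    ≡⟨ shift-cong K (geometric-rec 1≤K) n ⟩
      shift K one n
    ≡⟨ sym (mono≗shift-one K n) ⟩
      mono K n ∎
    where
    open ≡-Reasoning
    g = geometric K
    f = mono K ⊛ g

  mono⊛geometric-order : ∀ {K} → 1 ≤ K → OrderAtLeast 1 (mono K ⊛ geometric K)
  mono⊛geometric-order {K} 1≤K zero _ = trans (mono-⊛ K (geometric K) 0) (shift-< K _ 1≤K)
  mono⊛geometric-order 1≤K (suc x) (s≤s ())

open PowerSeries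

module FunctionalEquation (t : ℕ) (t≥1 : 1 ≤ t) where

  open import Data.Integer using (_+_; _*_; -_; _-_)

  [_] : ℕ → ℕ
  [_] = bracket t

  bracket-positive : ∀ j → 1 ≤ [ suc j ]
  bracket-positive j = ℕP.≤-trans (t^j≥1 j) (ℕP.m≤n+m (t ℕ.^ j) [ j ])
    where
    t^j≥1 : ∀ j → 1 ≤ t ℕ.^ j
    t^j≥1 zero = s≤s z≤n
    t^j≥1 (suc j) = ℕP.*-mono-≤ t≥1 (t^j≥1 j)

  bracket-suc : ∀ j → suc (t ℕ.* [ j ]) ≡ [ suc j ]
  bracket-suc zero = cong suc (ℕP.*-zeroʳ t)
  bracket-suc (suc j) = begin
      suc (t ℕ.* ([ j ] ℕ.+ t ℕ.^ j))
    ≡⟨ distrib t [ j ] (t ℕ.^ j) ⟩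
      suc (t ℕ.* [ j ]) ℕ.+ t ℕ.* t ℕ.^ j
    ≡⟨ cong (ℕ._+ t ℕ.* t ℕ.^ j) (bracket-suc j) ⟩
      [ suc j ] ℕ.+ t ℕ.* t ℕ.^ j ∎
    where
    open ≡-Reasoning
    distrib : ∀ t b p → suc (t ℕ.* (b ℕ.+ p)) ≡ suc (t ℕ.* b) ℕ.+ t ℕ.* p
    distrib = ℕSolver.solve-∀

  prodTo-rec : ∀ j → prodTo t (suc j) ⊖ shift [ suc j ] (prodTo t (suc j)) ≗ shift [ suc j ] (prodTo t j)
  prodTo-rec j n = begin
      (P ⊛ f) n - shift K (P ⊛ f) n
    ≡⟨ cong₂ _-_ (⊛-comm P f n) (shift-cong K (⊛-comm P f) n) ⟩
      (f ⊛ P) n - shift K (f ⊛ P) n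
    ≡⟨ cong (λ y → (f ⊛ P) n - y) (sym (shift-⊛ K f P n)) ⟩
      (f ⊛ P) n - (shift K f ⊛ P) n
    ≡⟨ sym (⊛-distribʳ-⊖ f (shift K f) P n) ⟩
      ((f ⊖ shift K f) ⊛ P) n
    ≡⟨ ⊛-congˡ P (mono⊛geometric-rec (bracket-positive j)) n ⟩
      (mono K ⊛ P) n
    ≡⟨ mono-⊛ K P n ⟩
      shift K P n ∎
    where
    open ≡-Reasoning
    K = [ suc j ]
    P = prodTo t j
    f = fracTerm t (suc j)

  prodTo-order : ∀ j → OrderAtLeast j (prodTo t j)
  prodTo-order zero x ()
  prodTo-order (suc j) x x<1+j =
    ⊛-order j 1 (prodTo-order j) (mono⊛geometric-order (bracket-positive j)) x
      (subst (x <_) (ℕP.+-comm 1 j) x<1+j)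

  -- term M j = (-1)^j q^(M[j]) Π_(i=1..j) q^[i]/(1 - q^[i]), so that
  -- numerator 0 is the denominator of the theorem and numerator 1 its numerator.
  term : ℕ → ℕ → Series
  term M j = sign j · shift (M ℕ.* [ j ]) (prodTo t j)

  numerator : ℕ → Series
  numerator M = infiniteSum (term M)

  term-order : ∀ M j → OrderAtLeast j (term M j)
  term-order M j x x<j =
    trans (cong (sign j *_) (shift-order (M ℕ.* [ j ]) (prodTo t j) (prodTo-order j) x x<j))
          (ℤP.*-zeroʳ (sign j))

  term-zero : ∀ M → term M 0 ≗ one
  term-zero M x =
    trans (cong (λ e → + 1 * shift e one x) (ℕP.*-zeroʳ M)) (ℤP.*-identityˡ (one x))

  exponent-identity : ∀ m j → suc m ℕ.+ t ℕ.* suc m ℕ.* [ j ] ≡ m ℕ.* [ suc j ] ℕ.+ [ suc j ]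
  exponent-identity m j = begin
      suc m ℕ.+ t ℕ.* suc m ℕ.* [ j ]
    ≡⟨ rearrange m t [ j ] ⟩
      m ℕ.* suc (t ℕ.* [ j ]) ℕ.+ suc (t ℕ.* [ j ])
    ≡⟨ cong (λ b → m ℕ.* b ℕ.+ b) (bracket-suc j) ⟩
      m ℕ.* [ suc j ] ℕ.+ [ suc j ] ∎
    where
    open ≡-Reasoning
    rearrange : ∀ m t b → suc m ℕ.+ t ℕ.* suc m ℕ.* b ≡ m ℕ.* suc (t ℕ.* b) ℕ.+ suc (t ℕ.* b)
    rearrange = ℕSolver.solve-∀

  term-step : ∀ m j → shift (suc m) (term (t ℕ.* suc m) j) ≗ term (suc m) (suc j) ⊖ term m (suc j)
  term-step m j n = begin
      shift (suc m) (λ x → s * shift (t ℕ.* suc m ℕ.* [ j ]) P x) n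
    ≡⟨ shift-map (suc m) (s *_) (ℤP.*-zeroʳ s) _ n ⟩
      s * shift (suc m) (shift (t ℕ.* suc m ℕ.* [ j ]) P) n
    ≡⟨ cong (s *_) (shift-shift (suc m) _ P n) ⟩
      s * shift (suc m ℕ.+ t ℕ.* suc m ℕ.* [ j ]) P n
    ≡⟨ cong (λ e → s * shift e P n) (exponent-identity m j) ⟩
      s * shift (mK ℕ.+ K) P n
    ≡⟨ cong (s *_) (sym (shift-shift mK K P n)) ⟩
      s * shift mK (shift K P) n
    ≡⟨ cong (s *_) (shift-cong mK (λ k → sym (prodTo-rec j k)) n) ⟩
      s * shift mK (P' ⊖ shift K P') n
    ≡⟨ cong (s *_) (shift-⊖ mK P' (shift K P') n) ⟩
      s * (shift mK P' n - shift mK (shift K P') n)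
    ≡⟨ cong (λ y → s * (shift mK P' n - y))
            (trans (shift-shift mK K P' n) (cong (λ e → shift e P' n) (ℕP.+-comm mK K))) ⟩
      s * (shift mK P' n - shift (K ℕ.+ mK) P' n)
    ≡⟨ negate-sign s (shift mK P' n) (shift (K ℕ.+ mK) P' n) ⟩
      (- + 1 * s) * shift (K ℕ.+ mK) P' n - (- + 1 * s) * shift mK P' n ∎
    where
    open ≡-Reasoning
    s = sign j
    K = [ suc j ]
    mK = m ℕ.* K
    P = prodTo t j
    P' = prodTo t (suc j)
    negate-sign : ∀ s x y → s * (x - y) ≡ (- + 1 * s) * y - (- + 1 * s) * x
    negate-sign = solve-∀

  numerator-rec : ∀ m → numerator (suc m) ≗ numerator m ⊕ shift (suc m) (numerator (t ℕ.* suc m))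
  numerator-rec m n = begin
      sumTo n (λ j → term (suc m) j n)
    ≡⟨ sumTo-cong n (λ j _ → add-difference (term (suc m) j n) (term m j n)) ⟩
      sumTo n (λ j → term m j n + (term (suc m) j ⊖ term m j) n)
    ≡⟨ sumTo-+ n _ _ ⟩
      numerator m n + sumTo n (λ j → (term (suc m) j ⊖ term m j) n)
    ≡⟨ cong (λ y → numerator m n + y) (differences n) ⟩
      numerator m n + shift (suc m) (numerator (t ℕ.* suc m)) n ∎
    where
    open ≡-Reasoning
    add-difference : ∀ x y → x ≡ y + (x - y)
    add-difference = solve-∀
    first-difference : ∀ x → (term (suc m) 0 ⊖ term m 0) x ≡ + 0
    first-difference x = trans (cong₂ _-_ (term-zero (suc m) x) (term-zero m x)) (ℤP.+-inverseʳ (one x))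
    differences : ∀ n → sumTo n (λ j → (term (suc m) j ⊖ term m j) n) ≡ shift (suc m) (numerator (t ℕ.* suc m)) n
    differences zero = first-difference 0
    differences (suc n) = begin
        sumTo (suc n) (λ j → (term (suc m) j ⊖ term m j) (suc n))
      ≡⟨ sumTo-unfoldˡ n _ ⟩
        (term (suc m) 0 ⊖ term m 0) (suc n) + sumTo n (λ j → (term (suc m) (suc j) ⊖ term m (suc j)) (suc n))
      ≡⟨ cong₂ _+_ (first-difference (suc n)) (sumTo-cong n (λ j _ → sym (term-step m j (suc n)))) ⟩
        + 0 + sumTo n (λ j → shift m (term (t ℕ.* suc m) j) n)
      ≡⟨ ℤP.+-identityˡ _ ⟩
        sumTo n (λ j → shift m (term (t ℕ.* suc m) j) n)
      ≡⟨ sym (shift-infiniteSum m (term (t ℕ.* suc m)) (term-order (t ℕ.* suc m)) n) ⟩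
        shift m (numerator (t ℕ.* suc m)) n ∎

  ratio : ℕ → Series
  ratio M = numerator M ⊛ inv (Denom t)

  ratio-zero : ratio 0 ≗ one
  ratio-zero = ⊛-inverseʳ (Denom t) refl

  ratio-rec : ∀ m → ratio (suc m) ≗ ratio m ⊕ shift (suc m) (ratio (t ℕ.* suc m))
  ratio-rec m n = begin
      (numerator (suc m) ⊛ I) n
    ≡⟨ ⊛-congˡ I (numerator-rec m) n ⟩
      ((numerator m ⊕ shift (suc m) (numerator (t ℕ.* suc m))) ⊛ I) n
    ≡⟨ ⊛-distribʳ-⊕ (numerator m) _ I n ⟩
      ratio m n + (shift (suc m) (numerator (t ℕ.* suc m)) ⊛ I) n
    ≡⟨ cong (λ y → ratio m n + y) (shift-⊛ (suc m) _ I n) ⟩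
      ratio m n + shift (suc m) (ratio (t ℕ.* suc m)) n ∎
    where
    open ≡-Reasoning
    I = inv (Denom t)

  Numer≗numerator-one : Numer t ≗ numerator 1
  Numer≗numerator-one n = sumTo-cong n λ j _ →
    cong (sign j *_) (trans (mono-⊛ [ j ] (prodTo t j) n)
                            (cong (λ e → shift e (prodTo t j) n) (sym (ℕP.*-identityˡ [ j ]))))

HasSize : Set → ℤ → Set
HasSize A z = Σ ℕ λ k → (Fin k ↔ A) × (+ k ≡ z)

HasSize-empty : ∀ {A} → ¬ A → HasSize A (+ 0)
HasSize-empty ¬a = 0 , mk↔ₛ′ (λ ()) (λ a → ⊥-elim (¬a a)) (λ a → ⊥-elim (¬a a)) (λ ()) , refl

HasSize-↔ : ∀ {A B z} → A ↔ B → HasSize A z → HasSize B z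
HasSize-↔ A↔B (k , Fin↔A , k≡z) = k , A↔B ↔-∘ Fin↔A , k≡z

HasSize-≡ : ∀ {A z z'} → z ≡ z' → HasSize A z → HasSize A z'
HasSize-≡ refl size = size

HasSize-⊎ : ∀ {A B x y} → HasSize A x → HasSize B y → HasSize (A ⊎ B) (x ℤ.+ y)
HasSize-⊎ (k , Fin↔A , k≡x) (l , Fin↔B , l≡y) =
  k ℕ.+ l , (Fin↔A ⊎-↔ Fin↔B) ↔-∘ +↔⊎ , trans (ℤP.pos-+ k l) (cong₂ ℤ._+_ k≡x l≡y)

HasSize-unique : ∀ {A c z} → Fin c ↔ A → HasSize A z → + c ≡ z
HasSize-unique Fin↔A (k , Fin↔A' , k≡z) = trans (cong +_ (↔⇒≡ (↔-sym Fin↔A' ↔-∘ Fin↔A))) k≡z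

-- weight t (a_0, …, a_l) = Σ a_i t^(l+1-i) = t^(l+1) · Σ a_i t^(-i)
weight : ℕ → List ℕ → ℕ
weight t [] = 0
weight t (a ∷ as) = a ℕ.* t ℕ.^ suc (length as) ℕ.+ weight t as

module Sequences (s : ℕ) where

  open import Data.Nat using (_+_; _*_; _^_)

  t : ℕ
  t = suc (suc s)

  LastPosOrEmpty : List ℕ → Set
  LastPosOrEmpty [] = ⊤
  LastPosOrEmpty (a ∷ as) = LastPos (a ∷ as)

  Admissible : ℕ → ℕ → List ℕ → Set
  Admissible m n as =
    (weight t as ≡ m * t ^ length as) × (sum as ≡ m + n * (t ∸ 1)) × LastPosOrEmpty as

  Sequence : ℕ → ℕ → Set
  Sequence m n = Σ (List ℕ) (Admissible m n)

  LastPos-irrelevant : ∀ as (p q : LastPos as) → p ≡ q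
  LastPos-irrelevant (a ∷ []) p q = ℕP.≤-irrelevant p q
  LastPos-irrelevant (a ∷ b ∷ as) p q = LastPos-irrelevant (b ∷ as) p q

  Admissible-irrelevant : ∀ m n as (p q : Admissible m n as) → p ≡ q
  Admissible-irrelevant m n [] (w , σ , tt) (w' , σ' , tt) =
    cong₂ _,_ (ℕP.≡-irrelevant w w') (cong (_, tt) (ℕP.≡-irrelevant σ σ'))
  Admissible-irrelevant m n (a ∷ as) (w , σ , l) (w' , σ' , l') =
    cong₂ _,_ (ℕP.≡-irrelevant w w') (cong₂ _,_ (ℕP.≡-irrelevant σ σ') (LastPos-irrelevant (a ∷ as) l l'))

  Sequence-≡ : ∀ {m n as} (p q : Admissible m n as) → _≡_ {A = Sequence m n} (as , p) (as , q)
  Sequence-≡ {m} {n} {as} p q = cong (as ,_) (Admissible-irrelevant m n as p q)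

  weight-positive : ∀ as → LastPos as → 0 < weight t as
  weight-positive (a ∷ []) a>0 = ℕP.<-≤-trans (ℕP.*-mono-< a>0 (ℕP.m^n>0 t 1)) (ℕP.m≤m+n _ 0)
  weight-positive (a ∷ b ∷ as) l =
    ℕP.<-≤-trans (weight-positive (b ∷ as) l) (ℕP.m≤n+m _ (a * t ^ suc (length (b ∷ as))))

  weight≤sum*t^length : ∀ as → weight t as ≤ sum as * t ^ length as
  weight≤sum*t^length [] = z≤n
  weight≤sum*t^length (a ∷ as) = begin
      a * T + weight t as
    ≤⟨ ℕP.+-monoʳ-≤ (a * T) (weight≤sum*t^length as) ⟩
      a * T + sum as * t ^ length as
    ≤⟨ ℕP.+-monoʳ-≤ (a * T) (ℕP.*-monoʳ-≤ (sum as) (ℕP.m≤n*m (t ^ length as) t)) ⟩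
      a * T + sum as * T
    ≡⟨ sym (ℕP.*-distribʳ-+ T a (sum as)) ⟩
      (a + sum as) * T ∎
    where
    open ℕP.≤-Reasoning
    T = t ^ suc (length as)

  Sequence-zero-size : ∀ n → HasSize (Sequence 0 n) (one n)
  Sequence-zero-size zero = 1 , ↔-sym only-empty ↔-∘ 1↔⊤ , refl
    where
    only-empty : Sequence 0 0 ↔ ⊤
    only-empty = mk↔ₛ′ (λ _ → tt) (λ _ → [] , refl , refl , tt) (λ _ → refl) λ
      { ([] , p) → Sequence-≡ {0} {0} _ p
      ; (a ∷ as , w , _ , l) → ⊥-elim (ℕP.<⇒≢ (weight-positive (a ∷ as) l) (sym w)) }
  Sequence-zero-size (suc n) = HasSize-empty λ
    { ([] , _ , () , _)
    ; (a ∷ as , w , _ , l) → ℕP.<⇒≢ (weight-positive (a ∷ as) l) (sym w) }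

  weight-decrement : ∀ m a as → weight t (suc a ∷ as) ≡ suc m * t ^ length (suc a ∷ as) →
                     weight t (a ∷ as) ≡ m * t ^ length (a ∷ as)
  weight-decrement m a as w =
    ℕP.+-cancelˡ-≡ T _ _ (trans (sym (ℕP.+-assoc T (a * T) (weight t as))) w)
    where T = t ^ suc (length as)

  decrement-head : ∀ m n a as → Admissible (suc m) n (suc a ∷ as) → LastPos (a ∷ as) →
                   Admissible m n (a ∷ as)
  decrement-head m n a as (w , σ , _) l = weight-decrement m a as w , ℕP.suc-injective σ , l

  increment-head : ∀ m n a as → Admissible m n (a ∷ as) → Admissible (suc m) n (suc a ∷ as)
  increment-head m n a as (w , σ , l) =
    trans (ℕP.+-assoc T (a * T) (weight t as)) (cong (λ x → T + x) w) , cong suc σ , still-last-pos as l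
    where
    T = t ^ suc (length as)
    still-last-pos : ∀ as → LastPos (a ∷ as) → LastPos (suc a ∷ as)
    still-last-pos [] _ = s≤s z≤n
    still-last-pos (b ∷ as) l = l

  one-from-empty : ∀ m n → Admissible m n [] → Admissible (suc m) n (1 ∷ [])
  one-from-empty zero n (_ , σ , _) = ℕP.+-identityʳ _ , cong suc σ , s≤s z≤n
  one-from-empty (suc m) n (() , _)

  empty-from-one : ∀ m n → Admissible (suc m) n (1 ∷ []) → Admissible m n []
  empty-from-one m n (w , σ , _) = trans m≡0 (sym (ℕP.*-identityʳ m)) , ℕP.suc-injective σ , tt
    where
    m≡0 : 0 ≡ m
    m≡0 = sym (ℕP.m*n≡0⇒m≡0 m (t ^ 1) (sym (weight-decrement m 0 [] w)))

  LeadingZero : ℕ → ℕ → Set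
  LeadingZero m n = Σ (List ℕ) λ as → Admissible (suc m) n (0 ∷ as)

  -- Either the first entry can be decreased (lowering Σ a_i t^(-i) by one), or it is zero.
  Sequence-suc↔ : ∀ m n → Sequence (suc m) n ↔ (Sequence m n ⊎ LeadingZero m n)
  Sequence-suc↔ m n = mk↔ₛ′ to from to-from from-to
    where
    to : Sequence (suc m) n → Sequence m n ⊎ LeadingZero m n
    to ([] , () , _)
    to (zero ∷ as , p) = inj₂ (as , p)
    to (1 ∷ [] , p) = inj₁ ([] , empty-from-one m n p)
    to (suc (suc a) ∷ [] , p) = inj₁ (suc a ∷ [] , decrement-head m n (suc a) [] p (s≤s z≤n))
    to (suc a ∷ b ∷ as , p@(_ , _ , l)) = inj₁ (a ∷ b ∷ as , decrement-head m n a (b ∷ as) p l)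
    from : Sequence m n ⊎ LeadingZero m n → Sequence (suc m) n
    from (inj₁ ([] , p)) = 1 ∷ [] , one-from-empty m n p
    from (inj₁ (a ∷ as , p)) = suc a ∷ as , increment-head m n a as p
    from (inj₂ (as , p)) = 0 ∷ as , p
    to-from : ∀ x → to (from x) ≡ x
    to-from (inj₁ ([] , p)) = cong inj₁ (Sequence-≡ {m} {n} _ p)
    to-from (inj₁ (zero ∷ [] , _ , _ , ()))
    to-from (inj₁ (suc a ∷ [] , p)) = cong inj₁ (Sequence-≡ {m} {n} _ p)
    to-from (inj₁ (zero ∷ b ∷ as , p)) = cong inj₁ (Sequence-≡ {m} {n} _ p)
    to-from (inj₁ (suc a ∷ b ∷ as , p)) = cong inj₁ (Sequence-≡ {m} {n} _ p)
    to-from (inj₂ (as , p)) = refl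
    from-to : ∀ x → from (to x) ≡ x
    from-to ([] , () , _)
    from-to (zero ∷ as , p) = refl
    from-to (1 ∷ [] , p) = Sequence-≡ {suc m} {n} _ p
    from-to (suc (suc a) ∷ [] , p) = Sequence-≡ {suc m} {n} _ p
    from-to (1 ∷ b ∷ as , p) = Sequence-≡ {suc m} {n} _ p
    from-to (suc (suc a) ∷ b ∷ as , p) = Sequence-≡ {suc m} {n} _ p

  drop-leading-zero : ∀ m n as → suc m ≤ n →
    Admissible (suc m) n (0 ∷ as) → Admissible (t * suc m) (n ∸ suc m) as
  drop-leading-zero m n [] _ (_ , _ , ())
  drop-leading-zero m n (b ∷ as) m<n (w , σ , l) =
    trans w (reassociate (suc m) t _) ,
    trans σ (trans (cong (λ k → suc m + k * suc s) (sym (ℕP.m+[n∸m]≡n m<n)))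
                   (regroup (suc m) (n ∸ suc m) s)) ,
    l
    where
    reassociate : ∀ M t x → M * (t * x) ≡ t * M * x
    reassociate = ℕSolver.solve-∀
    regroup : ∀ M k s → M + (M + k) * suc s ≡ suc (suc s) * M + k * suc s
    regroup = ℕSolver.solve-∀

  add-leading-zero : ∀ m n as → suc m ≤ n →
    Admissible (t * suc m) (n ∸ suc m) as → Admissible (suc m) n (0 ∷ as)
  add-leading-zero m n [] _ (() , _)
  add-leading-zero m n (b ∷ as) m<n (w , σ , l) =
    trans w (sym (reassociate (suc m) t _)) ,
    trans σ (trans (sym (regroup (suc m) (n ∸ suc m) s))
                   (cong (λ k → suc m + k * suc s) (ℕP.m+[n∸m]≡n m<n))) ,
    l
    where
    reassociate : ∀ M t x → M * (t * x) ≡ t * M * x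
    reassociate = ℕSolver.solve-∀
    regroup : ∀ M k s → M + (M + k) * suc s ≡ suc (suc s) * M + k * suc s
    regroup = ℕSolver.solve-∀

  LeadingZero↔ : ∀ m n → suc m ≤ n → LeadingZero m n ↔ Sequence (t * suc m) (n ∸ suc m)
  LeadingZero↔ m n m<n = mk↔ₛ′
    (λ { (as , p) → as , drop-leading-zero m n as m<n p })
    (λ { (as , p) → as , add-leading-zero m n as m<n p })
    (λ { (as , p) → Sequence-≡ {t * suc m} {n ∸ suc m} _ p })
    (λ { (as , p) → cong (as ,_) (Admissible-irrelevant (suc m) n (0 ∷ as) _ p) })

  -- A leading zero forces Σ a_i ≥ t(m+1), i.e. n ≥ m+1.
  LeadingZero-empty : ∀ m n → n < suc m → ¬ LeadingZero m n
  LeadingZero-empty m n n<1+m (as , w , σ , _) = ℕP.<⇒≱ n<1+m m<n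
    where
    T = t ^ length as
    scaled : suc m * t * T ≤ (suc m + n * suc s) * T
    scaled = subst₂ _≤_ (trans w (sym (ℕP.*-assoc (suc m) t T))) (cong (_* T) σ) (weight≤sum*t^length as)
    unscaled : suc m * t ≤ suc m + n * suc s
    unscaled = ℕP.*-cancelʳ-≤ (suc m * t) (suc m + n * suc s) T {{ℕ.>-nonZero (ℕP.m^n>0 t (length as))}} scaled
    expand : ∀ M s → M * suc (suc s) ≡ M + M * suc s
    expand = ℕSolver.solve-∀
    m<n : suc m ≤ n
    m<n = ℕP.*-cancelʳ-≤ (suc m) n (suc s)
      (ℕP.+-cancelˡ-≤ (suc m) _ _ (subst (_≤ suc m + n * suc s) (expand (suc m) s) unscaled))

  Sequence-size : (X : ℕ → Series) → X 0 ≗ one →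
    (∀ m → X (suc m) ≗ X m ⊕ shift (suc m) (X (t * suc m))) →
    ∀ n m → HasSize (Sequence m n) (X m n)
  Sequence-size X X-zero X-rec = <-rec _ size
    where
    size : ∀ n → (∀ {n'} → n' < n → ∀ m → HasSize (Sequence m n') (X m n')) →
           ∀ m → HasSize (Sequence m n) (X m n)
    size n ih zero = HasSize-≡ (sym (X-zero n)) (Sequence-zero-size n)
    size n ih (suc m) =
      HasSize-≡ (sym (X-rec m n))
        (HasSize-↔ (↔-sym (Sequence-suc↔ m n)) (HasSize-⊎ (size n ih m) leading-zero-size))
      where
      leading-zero-size : HasSize (LeadingZero m n) (shift (suc m) (X (t * suc m)) n)
      leading-zero-size with suc m ≤? n
      ... | yes m<n = HasSize-≡ (sym (shift-≤ (suc m) _ m<n))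
        (HasSize-↔ (↔-sym (LeadingZero↔ m n m<n))
          (ih (ℕP.∸-monoʳ-< {n} {suc m} {0} (s≤s z≤n) m<n) (t * suc m)))
      ... | no m≮n = HasSize-≡ (sym (shift-< (suc m) _ (ℕP.≰⇒> m≮n)))
        (HasSize-empty (LeadingZero-empty m n (ℕP.≰⇒> m≮n)))

toℚᵘ-/ : ∀ i d .{{_ : NonZero d}} → toℚᵘ (i ℚ./ d) ≃ (i ℚᵘ./ d)
toℚᵘ-/ i (suc d) = ℚP.toℚᵘ-fromℚᵘ (i ℚᵘ./ suc d)

0≃0/d : ∀ d .{{_ : NonZero d}} → toℚᵘ 0ℚ ≃ (+ 0 ℚᵘ./ d)
0≃0/d (suc d) = *≡* refl

1≃x/d⇒x≡d : ∀ x d .{{_ : NonZero d}} → toℚᵘ 1ℚ ≃ (+ x ℚᵘ./ d) → x ≡ d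
1≃x/d⇒x≡d x (suc d) (*≡* eq) =
  sym (ℤP.+-injective (trans (sym (ℤP.*-identityˡ (+ suc d))) (trans eq (ℤP.*-identityʳ (+ x)))))

d/d≃1 : ∀ d .{{_ : NonZero d}} → (+ d ℚᵘ./ d) ≃ toℚᵘ 1ℚ
d/d≃1 (suc d) = *≡* (trans (ℤP.*-identityʳ (+ suc d)) (sym (ℤP.*-identityˡ (+ suc d))))

a/T+r/TU≃[aU+r]/TU : ∀ a r T U .{{_ : NonZero T}} .{{_ : NonZero U}} .{{_ : NonZero (T ℕ.* U)}} →
  ((+ a) ℚᵘ./ T) ℚᵘ.+ ((+ r) ℚᵘ./ (T ℕ.* U)) ≃ (+ (a ℕ.* U ℕ.+ r) ℚᵘ./ (T ℕ.* U))
a/T+r/TU≃[aU+r]/TU a r (suc T) (suc U) = *≡* (begin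
    (+ a ℤ.* + TU ℤ.+ + r ℤ.* + suc T) ℤ.* + TU
  ≡⟨ cong (ℤ._* + TU) (cong₂ ℤ._+_ (sym (ℤP.pos-* a TU)) (sym (ℤP.pos-* r (suc T)))) ⟩
    (+ (a ℕ.* TU) ℤ.+ + (r ℕ.* suc T)) ℤ.* + TU
  ≡⟨ cong (ℤ._* + TU) (sym (ℤP.pos-+ (a ℕ.* TU) (r ℕ.* suc T))) ⟩
    + (a ℕ.* TU ℕ.+ r ℕ.* suc T) ℤ.* + TU
  ≡⟨ sym (ℤP.pos-* (a ℕ.* TU ℕ.+ r ℕ.* suc T) TU) ⟩
    + ((a ℕ.* TU ℕ.+ r ℕ.* suc T) ℕ.* TU)
  ≡⟨ cong +_ (cross-multiply a r (suc T) (suc U)) ⟩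
    + ((a ℕ.* suc U ℕ.+ r) ℕ.* (suc T ℕ.* TU))
  ≡⟨ ℤP.pos-* (a ℕ.* suc U ℕ.+ r) (suc T ℕ.* TU) ⟩
    + (a ℕ.* suc U ℕ.+ r) ℤ.* + (suc T ℕ.* TU) ∎)
  where
  open ≡-Reasoning
  TU = suc T ℕ.* suc U
  cross-multiply : ∀ a r T U →
    (a ℕ.* (T ℕ.* U) ℕ.+ r ℕ.* T) ℕ.* (T ℕ.* U) ≡ (a ℕ.* U ℕ.+ r) ℕ.* (T ℕ.* (T ℕ.* U))
  cross-multiply = ℕSolver.solve-∀

module WeightedSum (t : ℕ) .{{_ : NonZero t}} where

  infix 7 _/t^_
  _/t^_ : ℤ → ℕ → ℚᵘ
  i /t^ k = (i ℚᵘ./ t ℕ.^ k) {{ℕP.m^n≢0 t k}}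

  /t^-cong : ∀ i {k l} → k ≡ l → (i /t^ k) ≃ (i /t^ l)
  /t^-cong i refl = ℚᵘP.≃-refl

  a/t^k+r/t^[k+l] : ∀ a r k l →
    (+ a /t^ k) ℚᵘ.+ (+ r /t^ (k ℕ.+ l)) ≃ (+ (a ℕ.* t ℕ.^ l ℕ.+ r) /t^ (k ℕ.+ l))
  a/t^k+r/t^[k+l] a r k l = begin
      (+ a /t^ k) ℚᵘ.+ (+ r /t^ (k ℕ.+ l))
    ≈⟨ ℚᵘP.+-congʳ (+ a /t^ k) (ℚᵘP.≃-reflexive (ℚᵘP./-cong {{ℕP.m^n≢0 t (k ℕ.+ l)}} {{T*U≢0}} refl t^[k+l]≡T*U)) ⟩
      (+ a /t^ k) ℚᵘ.+ (+ r ℚᵘ./ (T ℕ.* U)) {{T*U≢0}}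
    ≈⟨ a/T+r/TU≃[aU+r]/TU a r T U {{ℕP.m^n≢0 t k}} {{ℕP.m^n≢0 t l}} {{T*U≢0}} ⟩
      (+ (a ℕ.* U ℕ.+ r) ℚᵘ./ (T ℕ.* U)) {{T*U≢0}}
    ≈⟨ ℚᵘP.≃-reflexive (ℚᵘP./-cong {{T*U≢0}} {{ℕP.m^n≢0 t (k ℕ.+ l)}} refl (sym t^[k+l]≡T*U)) ⟩
      + (a ℕ.* U ℕ.+ r) /t^ (k ℕ.+ l) ∎
    where
    open import Relation.Binary.Reasoning.Setoid ℚᵘP.≃-setoid
    T = t ℕ.^ k
    U = t ℕ.^ l
    T*U≢0 : NonZero (T ℕ.* U)
    T*U≢0 = ℕP.m*n≢0 T U {{ℕP.m^n≢0 t k}} {{ℕP.m^n≢0 t l}}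
    t^[k+l]≡T*U : t ℕ.^ (k ℕ.+ l) ≡ T ℕ.* U
    t^[k+l]≡T*U = ℕP.^-distribˡ-+-* t k l

  weightedSum≃weight : ∀ k as → toℚᵘ (weightedSum t k as) ≃ (+ weight t as /t^ (k ℕ.+ length as))
  weightedSum≃weight k [] = 0≃0/d (t ℕ.^ (k ℕ.+ 0)) {{ℕP.m^n≢0 t (k ℕ.+ 0)}}
  weightedSum≃weight k (a ∷ as) = begin
      toℚᵘ (head ℚ.+ weightedSum t (suc k) as)
    ≈⟨ ℚP.toℚᵘ-homo-+ head (weightedSum t (suc k) as) ⟩
      toℚᵘ head ℚᵘ.+ toℚᵘ (weightedSum t (suc k) as)
    ≈⟨ ℚᵘP.+-cong (toℚᵘ-/ (+ a) (t ℕ.^ k) {{ℕP.m^n≢0 t k}}) (weightedSum≃weight (suc k) as) ⟩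
      (+ a /t^ k) ℚᵘ.+ (+ weight t as /t^ (suc k ℕ.+ length as))
    ≈⟨ ℚᵘP.+-congʳ (+ a /t^ k) (/t^-cong (+ weight t as) (sym (ℕP.+-suc k (length as)))) ⟩
      (+ a /t^ k) ℚᵘ.+ (+ weight t as /t^ (k ℕ.+ suc (length as)))
    ≈⟨ a/t^k+r/t^[k+l] a (weight t as) k (suc (length as)) ⟩
      + weight t (a ∷ as) /t^ (k ℕ.+ length (a ∷ as)) ∎
    where
    open import Relation.Binary.Reasoning.Setoid ℚᵘP.≃-setoid
    head = (+ a ℚ./ t ℕ.^ k) {{ℕP.m^n≢0 t k}}

  weightedSum≡1⇒weight≡t^length : ∀ as → weightedSum t 0 as ≡ 1ℚ → weight t as ≡ t ℕ.^ length as
  weightedSum≡1⇒weight≡t^length as ws≡1 =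
    1≃x/d⇒x≡d (weight t as) (t ℕ.^ length as) {{ℕP.m^n≢0 t (length as)}}
      (ℚᵘP.≃-trans (ℚᵘP.≃-reflexive (cong toℚᵘ (sym ws≡1))) (weightedSum≃weight 0 as))

  weight≡t^length⇒weightedSum≡1 : ∀ as → weight t as ≡ t ℕ.^ length as → weightedSum t 0 as ≡ 1ℚ
  weight≡t^length⇒weightedSum≡1 as w≡t^l = ℚP.toℚᵘ-injective (begin
      toℚᵘ (weightedSum t 0 as)        ≈⟨ weightedSum≃weight 0 as ⟩
      + weight t as /t^ length as      ≡⟨ cong (_/t^ length as) (cong +_ w≡t^l) ⟩
      + t ℕ.^ length as /t^ length as  ≈⟨ d/d≃1 (t ℕ.^ length as) {{ℕP.m^n≢0 t (length as)}} ⟩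
      toℚᵘ 1ℚ                          ∎)
    where open import Relation.Binary.Reasoning.Setoid ℚᵘP.≃-setoid

module _ (s : ℕ) where

  open Sequences s
  open WeightedSum t

  ValidSeq↔Sequence-one : ∀ n → Σ (List ℕ) (ValidSeq t (s≤s (s≤s z≤n)) n) ↔ Sequence 1 n
  ValidSeq↔Sequence-one n = mk↔ₛ′ to from to-from from-to
    where
    to : Σ (List ℕ) (ValidSeq t (s≤s (s≤s z≤n)) n) → Sequence 1 n
    to (a ∷ as , l , σ , ws≡1) =
      a ∷ as , trans (weightedSum≡1⇒weight≡t^length (a ∷ as) ws≡1) (sym (ℕP.*-identityˡ _)) , σ , l
    from : Sequence 1 n → Σ (List ℕ) (ValidSeq t (s≤s (s≤s z≤n)) n)
    from ([] , () , _)
    from (a ∷ as , w , σ , l) =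
      a ∷ as , l , σ , weight≡t^length⇒weightedSum≡1 (a ∷ as) (trans w (ℕP.*-identityˡ _))
    to-from : ∀ x → to (from x) ≡ x
    to-from ([] , () , _)
    to-from (a ∷ as , p) = Sequence-≡ {1} {n} _ p
    from-to : ∀ x → from (to x) ≡ x
    from-to (a ∷ as , l , σ , ws≡1) = cong (λ v → a ∷ as , v)
      (cong₂ _,_ (LastPos-irrelevant (a ∷ as) _ l)
        (cong₂ _,_ (ℕP.≡-irrelevant _ σ) (UIP.Decidable⇒UIP.≡-irrelevant ℚP._≟_ _ ws≡1)))

theorem1 : (t : ℕ) → (h : 2 ≤ t) → (c : ℕ → ℕ)
    → (∀ n → Fin (c n) ↔ Σ (List ℕ) (ValidSeq t h n))
    → ∀ n → + (c n) ≡ (Numer t ⊛ inv (Denom t)) n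
theorem1 (suc (suc s)) (s≤s (s≤s z≤n)) c Fin↔ValidSeq n = begin
    + c n
  ≡⟨ HasSize-unique (ValidSeq↔Sequence-one s n ↔-∘ Fin↔ValidSeq n)
                    (Sequence-size ratio ratio-zero ratio-rec n 1) ⟩
    ratio 1 n
  ≡⟨ sym (⊛-congˡ (inv (Denom t)) Numer≗numerator-one n) ⟩
    (Numer t ⊛ inv (Denom t)) n ∎
  where
  open ≡-Reasoning
  open Sequences s
  open FunctionalEquation t (s≤s z≤n)
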